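{- Let $s\ge 0$ and $L\ge 1$ be integers and let $c_1,\dots,c_L$ be non-negative integers with $c_1=\cdots=c_s=0$, $c_{s+1}>0$, $c_L>0$, and $\gcd\{m : c_m\neq 0\}=1$, and let $\{G_n\}_{n=1}^\infty$ be the associated $s$-deep Zero Linear Recurrence Sequence satisfying $G_{n+1}=c_1G_n+\cdots+c_sG_{n+1-s}+c_{s+1}G_{n-s}+\cdots+c_LG_{n+1-L}$ (as defined in the context). Suppose $c_{s+1}>s$, $c_{s+2}>0$ and $c_L>1$. Then \[G_{s+L+2}-c_{s+1}G_{L+2}-c_{s+2}G_{L+1}-\cdots-c_{L-1}G_{s+4}-G_{s+3}<0.\]
   Context: An $s$-deep Zero Linear Recurrence Relation (ZLRR) is a recurrence $G_{n+1}=c_1G_n+\cdots+c_LG_{n+1-L}$ with non-negative integer coefficients, $c_1=\cdots=c_s=0$, $L$, $c_{s+1}$, $c_L$ positive, and $\gcd$ of $\{m: c_m\ne 0\}$ equal to $1$. The associated $s$-deep ZLRS $\{G_n\}_{n\ge1}$ is the sequence of positive integers satisfying this recurrence for all $n\ge L$, with initial values $G_1=1,\dots,G_{s+1}=s+1$, and for $s+2\le n\le L$: $G_n=n$ if $c_{s+1}\le s$, and $G_n=c_{s+1}G_{n-s-1}+c_{s+2}G_{n-s-2}+\cdots+c_{n-1}G_1+1$ if $c_{s+1}>s$ (with the single exception that for $G_{n+1}=G_{n-1}+G_{n-2}$ the initial values are $G_1=1,G_2=2,G_3=4$). -}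

module Defs where

open import Data.Nat using (ℕ; zero; suc; _+_; _*_; _∸_; _≤ᵇ_; _≡ᵇ_)
open import Data.Nat.Divisibility using (_∣_)
open import Data.Bool using (Bool; true; false; if_then_else_; _∧_)
open import Data.List using (List; map; upTo)
open import Data.Nat.ListAction using (sum)
open import Relation.Binary.PropositionalEquality using (_≡_; _≢_)

sumRange : ℕ → ℕ → (ℕ → ℕ) → ℕ
sumRange a b f = sum (map (λ i → f (a + i)) (upTo (suc b ∸ a)))

-- Coefficients are given as c : ℕ → ℕ, with c m the coefficient c_m for 1 ≤ m ≤ L
-- (values outside 1..L are never used).

isException : ℕ → ℕ → (ℕ → ℕ) → Bool
isException s L c =
  (s ≡ᵇ 1) ∧ (L ≡ᵇ 3) ∧ (c 1 ≡ᵇ 0) ∧ (c 2 ≡ᵇ 1) ∧ (c 3 ≡ᵇ 1)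

-- G_n computed from the earlier values g k = G_k (1 ≤ k < n).
zlrsStep : (s L : ℕ) (c : ℕ → ℕ) (n : ℕ) (g : ℕ → ℕ) → ℕ
zlrsStep s L c n g =
  if isException s L c ∧ (n ≡ᵇ 3) then 4
  else if n ≤ᵇ suc s then n
  else if n ≤ᵇ L then
    (if c (suc s) ≤ᵇ s then n
     else sumRange (suc s) (n ∸ 1) (λ m → c m * g (n ∸ m)) + 1)
  else sumRange 1 L (λ m → c m * g (n ∸ m))

-- table n k = G_k for 1 ≤ k ≤ n
zlrsTable : (s L : ℕ) (c : ℕ → ℕ) → ℕ → ℕ → ℕ
zlrsTable s L c zero    = λ _ → 0
zlrsTable s L c (suc n) = λ k →
  if k ≤ᵇ n then zlrsTable s L c n k
  else zlrsStep s L c (suc n) (zlrsTable s L c n)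

-- The s-deep ZLRS G_n (n ≥ 1) associated with (s, L, c); G 0 is a dummy value 0.
G : (s L : ℕ) (c : ℕ → ℕ) → ℕ → ℕ
G s L c n = zlrsTable s L c n n

-- gcd {m ∈ [1,L] : c_m ≠ 0} = 1, stated as: every common divisor of that set divides 1.
GcdOne : (L : ℕ) (c : ℕ → ℕ) → Set
GcdOne L c = ∀ d → (∀ m → 1 Data.Nat.≤ m → m Data.Nat.≤ L → c m ≢ 0 → d ∣ m) → d ∣ 1

IsZLRR : (s L : ℕ) (c : ℕ → ℕ) → Set
IsZLRR s L c =
  (1 Data.Nat.≤ L) Data.Product.×
  ((∀ m → 1 Data.Nat.≤ m → m Data.Nat.≤ s → c m ≡ 0) Data.Product.×
  ((suc s Data.Nat.≤ L) Data.Product.×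
  ((0 Data.Nat.< c (suc s)) Data.Product.×
  ((0 Data.Nat.< c L) Data.Product.×
  GcdOne L c))))
  where import Data.Product

{-# OPTIONS --safe #-}
-- Since c_{s+1} > s, the sequence G is nondecreasing: G_{s+2} ≥ c_{s+1} G_1 ≥ s + 1 = G_{s+1},
-- and beyond that the sums defining G_n and G_{n+1} compare term by term (the shift only
-- raises each index, and at n = L the constant 1 is replaced by c_L G_1 ≥ 1).
-- Now write G_{s+L+2} = Σ_{m=s+1}^{L} c_m G_{s+L+2-m} and compare it with the
-- right-hand sum term by term.  The unmatched term c_L G_{s+2} = c_L (c_{s+1} + 1)
-- is paid for by the gain c_{s+1} (G_{L+2} − G_{L+1}) ≥ c_{s+1} c_L of the first term
-- and the gain c_{s+2} (G_{L+1} − G_L) ≥ c_L − 1 of the second, leaving an excess of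
-- at most 1 < G_{s+3}.  When L = s + 2 there is no second term; then c_L < G_{L+1}
-- = G_{s+3} instead.

module Submission where

open import Data.Bool using (true; false; if_then_else_; T; _∧_)
open import Data.Bool.Properties using (∧-zeroʳ)
open import Data.List using (applyUpTo; map; upTo; [_]; _∷ʳ_)
open import Data.List.Properties using (applyUpTo-∷ʳ; map-upTo)
open import Data.Nat using (ℕ; zero; suc; _+_; _*_; _∸_; _≤_; _<_; z≤n; s≤s; s≤s⁻¹; z<s; s<s; _≤ᵇ_; _≡ᵇ_; _≤?_)
open import Data.Nat.ListAction using (sum)
open import Data.Nat.ListAction.Properties using (sum-++)
open import Data.Nat.Properties
open import Algebra.Properties.CommutativeSemigroup +-commutativeSemigroup using (xy∙z≈xz∙y)
open import Data.Nat.Tactic.RingSolver using (solve-∀)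
open import Data.Product using (_,_)
open import Data.Sum using (inj₁; inj₂)
open import Data.Unit using (tt)
open import Function using (_∘_)
open import Relation.Binary.Definitions using (tri<; tri≈; tri>)
open import Relation.Binary.PropositionalEquality
  using (_≡_; refl; sym; trans; cong; cong₂; subst; subst₂; module ≡-Reasoning)
open import Relation.Nullary using (¬_; yes; no; contradiction)

open import Defs

if-T : ∀ {A : Set} {b} {x y : A} → T b → (if b then x else y) ≡ x
if-T {b = true} _ = refl

if-¬T : ∀ {A : Set} {b} {x y : A} → ¬ T b → (if b then x else y) ≡ y
if-¬T {b = false} _  = refl
if-¬T {b = true}  ¬t = contradiction tt ¬t

if-≤ : ∀ {A : Set} {m n} {x y : A} → m ≤ n → (if m ≤ᵇ n then x else y) ≡ x
if-≤ = if-T ∘ ≤⇒≤ᵇ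

if-≰ : ∀ {A : Set} {m n} {x y : A} → ¬ m ≤ n → (if m ≤ᵇ n then x else y) ≡ y
if-≰ {m = m} {n} m≰n = if-¬T (m≰n ∘ ≤ᵇ⇒≤ m n)

sum-applyUpTo-cong : ∀ {f g : ℕ → ℕ} n → (∀ i → i < n → f i ≡ g i) →
                     sum (applyUpTo f n) ≡ sum (applyUpTo g n)
sum-applyUpTo-cong zero    _  = refl
sum-applyUpTo-cong (suc n) eq =
  cong₂ _+_ (eq 0 z<s) (sum-applyUpTo-cong n (λ i i<n → eq (suc i) (s<s i<n)))

sum-applyUpTo-mono-≤ : ∀ {f g : ℕ → ℕ} n → (∀ i → i < n → f i ≤ g i) →
                       sum (applyUpTo f n) ≤ sum (applyUpTo g n)
sum-applyUpTo-mono-≤ zero    _  = z≤n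
sum-applyUpTo-mono-≤ (suc n) le =
  +-mono-≤ (le 0 z<s) (sum-applyUpTo-mono-≤ n (λ i i<n → le (suc i) (s<s i<n)))

sum-applyUpTo-∷ʳ : ∀ (f : ℕ → ℕ) n → sum (applyUpTo f (suc n)) ≡ sum (applyUpTo f n) + f n
sum-applyUpTo-∷ʳ f n = begin
  sum (applyUpTo f (suc n))              ≡⟨ cong sum (applyUpTo-∷ʳ f n) ⟨
  sum (applyUpTo f n ∷ʳ f n)             ≡⟨ sum-++ (applyUpTo f n) [ f n ] ⟩
  sum (applyUpTo f n) + (f n + 0)        ≡⟨ cong (sum (applyUpTo f n) +_) (+-identityʳ (f n)) ⟩
  sum (applyUpTo f n) + f n              ∎
  where open ≡-Reasoning

sumRange-applyUpTo : ∀ a b f → sumRange a b f ≡ sum (applyUpTo (λ i → f (a + i)) (suc b ∸ a))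
sumRange-applyUpTo a b f = cong sum (map-upTo (λ i → f (a + i)) (suc b ∸ a))

i<1+b∸a⇒a+i≤b : ∀ {a b i} → i < suc b ∸ a → a + i ≤ b
i<1+b∸a⇒a+i≤b {a} {b} {i} i< = begin
  a + i ≡⟨ +-comm a i ⟩
  i + a ≤⟨ s≤s⁻¹ (m≤o∸n⇒m+n≤o (suc i) a≤1+b i<) ⟩
  b     ∎
  where
  open ≤-Reasoning
  a≤1+b : a ≤ suc b
  a≤1+b = <⇒≤ (m∸n≢0⇒n<m (λ eq → n≮0 (subst (i <_) eq i<)))

sumRange-cong : ∀ {a b} {f g : ℕ → ℕ} → (∀ m → a ≤ m → m ≤ b → f m ≡ g m) →
                sumRange a b f ≡ sumRange a b g
sumRange-cong {a} {b} {f} {g} eq = begin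
  sumRange a b f                                        ≡⟨ sumRange-applyUpTo a b f ⟩
  sum (applyUpTo (λ i → f (a + i)) (suc b ∸ a))        ≡⟨ sum-applyUpTo-cong (suc b ∸ a) eqᵢ ⟩
  sum (applyUpTo (λ i → g (a + i)) (suc b ∸ a))        ≡⟨ sumRange-applyUpTo a b g ⟨
  sumRange a b g                                        ∎
  where
  open ≡-Reasoning
  eqᵢ : ∀ i → i < suc b ∸ a → f (a + i) ≡ g (a + i)
  eqᵢ i i< = eq (a + i) (m≤m+n a i) (i<1+b∸a⇒a+i≤b i<)

sumRange-mono-≤ : ∀ {a b} {f g : ℕ → ℕ} → (∀ m → a ≤ m → m ≤ b → f m ≤ g m) →
                  sumRange a b f ≤ sumRange a b g
sumRange-mono-≤ {a} {b} {f} {g} le = begin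
  sumRange a b f                                        ≡⟨ sumRange-applyUpTo a b f ⟩
  sum (applyUpTo (λ i → f (a + i)) (suc b ∸ a))        ≤⟨ sum-applyUpTo-mono-≤ (suc b ∸ a) leᵢ ⟩
  sum (applyUpTo (λ i → g (a + i)) (suc b ∸ a))        ≡⟨ sumRange-applyUpTo a b g ⟨
  sumRange a b g                                        ∎
  where
  open ≤-Reasoning
  leᵢ : ∀ i → i < suc b ∸ a → f (a + i) ≤ g (a + i)
  leᵢ i i< = le (a + i) (m≤m+n a i) (i<1+b∸a⇒a+i≤b i<)

sumRange-empty : ∀ {a b} (f : ℕ → ℕ) → b < a → sumRange a b f ≡ 0
sumRange-empty {a} f b<a = cong (λ n → sum (map (λ i → f (a + i)) (upTo n))) (m≤n⇒m∸n≡0 b<a)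

sumRange-first : ∀ {a b} (f : ℕ → ℕ) → a ≤ b → sumRange a b f ≡ f a + sumRange (suc a) b f
sumRange-first {a} {b} f a≤b = begin
  sumRange a b f                                              ≡⟨ sumRange-applyUpTo a b f ⟩
  sum (applyUpTo (λ i → f (a + i)) (suc b ∸ a))              ≡⟨ cong (sum ∘ applyUpTo _) (+-∸-assoc 1 a≤b) ⟩
  f (a + 0) + sum (applyUpTo (λ i → f (a + suc i)) (b ∸ a))  ≡⟨ cong₂ _+_ (cong f (+-identityʳ a)) shift ⟩
  f a + sum (applyUpTo (λ i → f (suc a + i)) (b ∸ a))        ≡⟨ cong (f a +_) (sumRange-applyUpTo (suc a) b f) ⟨
  f a + sumRange (suc a) b f                                  ∎
  where
  open ≡-Reasoning
  shift : sum (applyUpTo (λ i → f (a + suc i)) (b ∸ a)) ≡ sum (applyUpTo (λ i → f (suc a + i)) (b ∸ a))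
  shift = sum-applyUpTo-cong (b ∸ a) (λ i _ → cong f (+-suc a i))

sumRange-last : ∀ {a b} (f : ℕ → ℕ) → a ≤ suc b → sumRange a (suc b) f ≡ sumRange a b f + f (suc b)
sumRange-last {a} {b} f a≤1+b = begin
  sumRange a (suc b) f                                          ≡⟨ sumRange-applyUpTo a (suc b) f ⟩
  sum (applyUpTo (λ i → f (a + i)) (suc (suc b) ∸ a))          ≡⟨ cong (sum ∘ applyUpTo _) (+-∸-assoc 1 a≤1+b) ⟩
  sum (applyUpTo (λ i → f (a + i)) (suc (suc b ∸ a)))          ≡⟨ sum-applyUpTo-∷ʳ _ (suc b ∸ a) ⟩
  sum (applyUpTo (λ i → f (a + i)) (suc b ∸ a)) + f (a + (suc b ∸ a))
    ≡⟨ cong₂ _+_ (sumRange-applyUpTo a b f) (cong f (sym (m+[n∸m]≡n a≤1+b))) ⟨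
  sumRange a b f + f (suc b)                                    ∎
  where open ≡-Reasoning

sumRange-vanishing-prefix : ∀ {a b} d (f : ℕ → ℕ) → (∀ m → a ≤ m → m < a + d → f m ≡ 0) →
                            a + d ≤ suc b → sumRange a b f ≡ sumRange (a + d) b f
sumRange-vanishing-prefix {a} {b} zero f _ _ = cong (λ x → sumRange x b f) (sym (+-identityʳ a))
sumRange-vanishing-prefix {a} {b} (suc d) f zero≤ a+d<1+b = begin
  sumRange a b f                  ≡⟨ sumRange-first f a≤b ⟩
  f a + sumRange (suc a) b f      ≡⟨ cong (_+ sumRange (suc a) b f) (zero≤ a ≤-refl a<a+1+d) ⟩
  sumRange (suc a) b f            ≡⟨ sumRange-vanishing-prefix d f zero≤′ 1+a+d≤1+b ⟩
  sumRange (suc a + d) b f        ≡⟨ cong (λ x → sumRange x b f) (sym (+-suc a d)) ⟩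
  sumRange (a + suc d) b f        ∎
  where
  open ≡-Reasoning
  a<a+1+d : a < a + suc d
  a<a+1+d = m<m+n a z<s
  a≤b : a ≤ b
  a≤b = s≤s⁻¹ (≤-trans a<a+1+d a+d<1+b)
  zero≤′ : ∀ m → suc a ≤ m → m < suc a + d → f m ≡ 0
  zero≤′ m a<m m<a+1+d = zero≤ m (<⇒≤ a<m) (≤-trans m<a+1+d (≤-reflexive (sym (+-suc a d))))
  1+a+d≤1+b : suc a + d ≤ suc b
  1+a+d≤1+b = ≤-trans (≤-reflexive (sym (+-suc a d))) a+d<1+b

NondecreasingBelow : (ℕ → ℕ) → ℕ → Set
NondecreasingBelow f n = ∀ m → m < n → f m ≤ f (suc m)

1<n⇒[n≡ᵇ1]≡false : ∀ {n} → 1 < n → (n ≡ᵇ 1) ≡ false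
1<n⇒[n≡ᵇ1]≡false {suc zero}    (s≤s ())
1<n⇒[n≡ᵇ1]≡false {suc (suc n)} _ = refl

isException-false : ∀ s L c → s < c (suc s) → isException s L c ≡ false
isException-false zero          L c _    = refl
isException-false (suc (suc s)) L c _    = refl
isException-false (suc zero)    L c 1<c₂
  rewrite 1<n⇒[n≡ᵇ1]≡false 1<c₂ | ∧-zeroʳ (c 1 ≡ᵇ 0) = ∧-zeroʳ (L ≡ᵇ 3)

module ZLRS (s L : ℕ) (c : ℕ → ℕ) where

  g : ℕ → ℕ
  g = G s L c

  lagSum : ℕ → ℕ → ℕ → ℕ
  lagSum a b n = sumRange a b (λ m → c m * g (n ∸ m))

  zlrsTable≡G : ∀ {n k} → k ≤ n → zlrsTable s L c n k ≡ g k
  zlrsTable≡G {zero}      z≤n   = refl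
  zlrsTable≡G {suc n} {k} k≤1+n with m≤n⇒m<n∨m≡n k≤1+n
  ... | inj₁ k<1+n = trans (if-≤ (s≤s⁻¹ k<1+n)) (zlrsTable≡G (s≤s⁻¹ k<1+n))
  ... | inj₂ refl  = refl

  G-suc : ∀ n → g (suc n) ≡ zlrsStep s L c (suc n) (zlrsTable s L c n)
  G-suc n = if-≰ (1+n≰n {n})

  tableSum≡lagSum : ∀ a b n → 0 < a →
    sumRange a b (λ m → c m * zlrsTable s L c n (suc n ∸ m)) ≡ lagSum a b (suc n)
  tableSum≡lagSum a b n 0<a = sumRange-cong λ m a≤m _ →
    cong (c m *_) (zlrsTable≡G (∸-monoʳ-≤ (suc n) (≤-trans 0<a a≤m)))

  lagSum-empty : ∀ {a b} n → b < a → lagSum a b n ≡ 0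
  lagSum-empty n = sumRange-empty (λ m → c m * g (n ∸ m))

  lagSum-last : ∀ {a b} n → a ≤ suc b → lagSum a (suc b) n ≡ lagSum a b n + c (suc b) * g (n ∸ suc b)
  lagSum-last n = sumRange-last (λ m → c m * g (n ∸ m))

  lagSum-first : ∀ {a b} n → a ≤ b → lagSum a b n ≡ c a * g (n ∸ a) + lagSum (suc a) b n
  lagSum-first n = sumRange-first (λ m → c m * g (n ∸ m))

  lagSum-shift-mono : ∀ a b {n} → NondecreasingBelow g n → 0 < a → b ≤ n →
                      lagSum a b n ≤ lagSum a b (suc n)
  lagSum-shift-mono a b {n} mono 0<a b≤n = sumRange-mono-≤ λ m a≤m m≤b →
    *-monoʳ-≤ (c m) (shift (≤-trans 0<a a≤m) (≤-trans m≤b b≤n))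
    where
    shift : ∀ {m} → 0 < m → m ≤ n → g (n ∸ m) ≤ g (suc n ∸ m)
    shift {m} 0<m m≤n = subst (λ k → g (n ∸ m) ≤ g k) (sym (+-∸-assoc 1 m≤n))
                              (mono (n ∸ m) (∸-monoʳ-< 0<m m≤n))

module Evaluation (s L : ℕ) (c : ℕ → ℕ) (c-deep : ∀ m → 1 ≤ m → m ≤ s → c m ≡ 0)
               (s<c₁ : s < c (suc s)) where

  open ZLRS s L c

  private
    not-exceptional : ∀ {b} → ¬ T (isException s L c ∧ b)
    not-exceptional {b} = subst (λ e → ¬ T (e ∧ b)) (sym (isException-false s L c s<c₁)) λ ()

  G-initial : ∀ {n} → n ≤ suc s → g n ≡ n
  G-initial {zero}  _     = refl
  G-initial {suc n} n≤1+s = trans (G-suc n) (trans (if-¬T not-exceptional) (if-≤ n≤1+s))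

  G-middle : ∀ {k} → suc s ≤ k → suc k ≤ L → g (suc k) ≡ lagSum (suc s) k (suc k) + 1
  G-middle {k} s<k k<L = begin
    g (suc k)
      ≡⟨ G-suc k ⟩
    zlrsStep s L c (suc k) (zlrsTable s L c k)
      ≡⟨ trans (if-¬T not-exceptional) (trans (if-≰ (<⇒≱ (s≤s s<k))) (trans (if-≤ k<L) (if-≰ (<⇒≱ s<c₁)))) ⟩
    sumRange (suc s) k (λ m → c m * zlrsTable s L c k (suc k ∸ m)) + 1
      ≡⟨ cong (_+ 1) (tableSum≡lagSum (suc s) k k z<s) ⟩
    lagSum (suc s) k (suc k) + 1
      ∎
    where open ≡-Reasoning

  lagSum-deep : ∀ n → s ≤ L → lagSum 1 L n ≡ lagSum (suc s) L n
  lagSum-deep n s≤L = sumRange-vanishing-prefix s _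
    (λ m 1≤m m<1+s → cong (_* g (n ∸ m)) (c-deep m 1≤m (s≤s⁻¹ m<1+s))) (s≤s s≤L)

  G-recurrence : ∀ {k} → suc s ≤ L → L ≤ k → g (suc k) ≡ lagSum (suc s) L (suc k)
  G-recurrence {k} s<L L≤k = begin
    g (suc k)
      ≡⟨ G-suc k ⟩
    zlrsStep s L c (suc k) (zlrsTable s L c k)
      ≡⟨ trans (if-¬T not-exceptional) (trans (if-≰ (<⇒≱ (s≤s (≤-trans s<L L≤k)))) (if-≰ (<⇒≱ (s≤s L≤k)))) ⟩
    sumRange 1 L (λ m → c m * zlrsTable s L c k (suc k ∸ m))
      ≡⟨ tableSum≡lagSum 1 L k z<s ⟩
    lagSum 1 L (suc k)
      ≡⟨ lagSum-deep (suc k) (<⇒≤ s<L) ⟩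
    lagSum (suc s) L (suc k)
      ∎
    where open ≡-Reasoning

  G₁ : g 1 ≡ 1
  G₁ = G-initial (s≤s z≤n)

  lagSum-endpoint : ∀ {a b} → a ≤ suc b →
                    lagSum a (suc b) (suc (suc b)) ≡ lagSum a b (suc (suc b)) + c (suc b)
  lagSum-endpoint {a} {b} a≤1+b = begin
    lagSum a (suc b) (suc (suc b))     ≡⟨ lagSum-last (suc (suc b)) a≤1+b ⟩
    S + c (suc b) * g (1 + b ∸ b)      ≡⟨ cong (λ k → S + c (suc b) * g k) (m+n∸n≡m 1 b) ⟩
    S + c (suc b) * g 1                ≡⟨ cong (λ x → S + c (suc b) * x) G₁ ⟩
    S + c (suc b) * 1                  ≡⟨ cong (S +_) (*-identityʳ (c (suc b))) ⟩
    S + c (suc b)                      ∎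
    where
    open ≡-Reasoning
    S : ℕ
    S = lagSum a b (suc (suc b))

  lagSum-initial : lagSum (suc s) (suc s) (suc (suc s)) ≡ c (suc s)
  lagSum-initial =
    trans (lagSum-endpoint ≤-refl) (cong (_+ c (suc s)) (lagSum-empty (suc (suc s)) (n<1+n s)))

  G-first-middle : suc (suc s) ≤ L → g (suc (suc s)) ≡ c (suc s) + 1
  G-first-middle 2+s≤L = trans (G-middle ≤-refl 2+s≤L) (cong (_+ 1) lagSum-initial)

module Monotone (s L : ℕ) (c : ℕ → ℕ) (c-deep : ∀ m → 1 ≤ m → m ≤ s → c m ≡ 0)
                (s<c₁ : s < c (suc s)) (s<L : s < L) (0<cL : 0 < c L) where

  open ZLRS s L c
  open Evaluation s L c c-deep s<c₁

  c₁≤G₂₊ₛ : c (suc s) ≤ g (suc (suc s))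
  c₁≤G₂₊ₛ with suc (suc s) ≤? L
  ... | yes 2+s≤L = ≤-trans (m≤m+n _ 1) (≤-reflexive (sym (G-first-middle 2+s≤L)))
  ... | no  2+s≰L = ≤-reflexive (sym (begin
    g (suc (suc s))                      ≡⟨ G-recurrence s<L L≤1+s ⟩
    lagSum (suc s) L (suc (suc s))       ≡⟨ cong (λ b → lagSum (suc s) b (suc (suc s))) L≡1+s ⟩
    lagSum (suc s) (suc s) (suc (suc s)) ≡⟨ lagSum-initial ⟩
    c (suc s)                            ∎))
    where
    open ≡-Reasoning
    L≤1+s : L ≤ suc s
    L≤1+s = s≤s⁻¹ (≰⇒> 2+s≰L)
    L≡1+s : L ≡ suc s
    L≡1+s = ≤-antisym L≤1+s s<L

  mono-middle : ∀ {k} → suc s ≤ k → suc (suc k) ≤ L → NondecreasingBelow g (suc k) →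
                g (suc k) ≤ g (suc (suc k))
  mono-middle {k} s<k k+1<L mono = begin
    g (suc k)
      ≡⟨ G-middle s<k (<⇒≤ k+1<L) ⟩
    lagSum (suc s) k (suc k) + 1
      ≤⟨ +-monoˡ-≤ 1 (lagSum-shift-mono (suc s) k mono z<s (n≤1+n k)) ⟩
    lagSum (suc s) k (suc (suc k)) + 1
      ≤⟨ +-monoˡ-≤ 1 (m≤m+n _ _) ⟩
    lagSum (suc s) k (suc (suc k)) + c (suc k) * g (1 + k ∸ k) + 1
      ≡⟨ cong (_+ 1) (lagSum-last (suc (suc k)) (m≤n⇒m≤1+n s<k)) ⟨
    lagSum (suc s) (suc k) (suc (suc k)) + 1
      ≡⟨ G-middle (m≤n⇒m≤1+n s<k) k+1<L ⟨
    g (suc (suc k))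
      ∎
    where open ≤-Reasoning

  mono-boundary : ∀ {k} → suc s ≤ k → suc k ≡ L → NondecreasingBelow g (suc k) →
                  g (suc k) + c L ≤ g (suc (suc k)) + 1
  mono-boundary {k} s<k k+1≡L mono = begin
    g (suc k) + c L
      ≡⟨ cong (_+ c L) (G-middle s<k (≤-reflexive k+1≡L)) ⟩
    lagSum (suc s) k (suc k) + 1 + c L
      ≤⟨ +-monoˡ-≤ (c L) (+-monoˡ-≤ 1 (lagSum-shift-mono (suc s) k mono z<s (n≤1+n k))) ⟩
    lagSum (suc s) k (suc (suc k)) + 1 + c L
      ≡⟨ xy∙z≈xz∙y _ 1 (c L) ⟩
    lagSum (suc s) k (suc (suc k)) + c L + 1
      ≡⟨ cong (λ m → lagSum (suc s) k (suc (suc k)) + c m + 1) k+1≡L ⟨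
    lagSum (suc s) k (suc (suc k)) + c (suc k) + 1
      ≡⟨ cong (_+ 1) (lagSum-endpoint (m≤n⇒m≤1+n s<k)) ⟨
    lagSum (suc s) (suc k) (suc (suc k)) + 1
      ≡⟨ cong (λ b → lagSum (suc s) b (suc (suc k)) + 1) k+1≡L ⟩
    lagSum (suc s) L (suc (suc k)) + 1
      ≡⟨ cong (_+ 1) (G-recurrence s<L (≤-reflexive (sym k+1≡L))) ⟨
    g (suc (suc k)) + 1
      ∎
    where open ≤-Reasoning

  mono-recurrence : ∀ {k} → L ≤ k → NondecreasingBelow g (suc k) → g (suc k) ≤ g (suc (suc k))
  mono-recurrence {k} L≤k mono = begin
    g (suc k)                       ≡⟨ G-recurrence s<L L≤k ⟩
    lagSum (suc s) L (suc k)        ≤⟨ lagSum-shift-mono (suc s) L mono z<s (m≤n⇒m≤1+n L≤k) ⟩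
    lagSum (suc s) L (suc (suc k))  ≡⟨ G-recurrence s<L (m≤n⇒m≤1+n L≤k) ⟨
    g (suc (suc k))                 ∎
    where open ≤-Reasoning

  mono-step : ∀ n → NondecreasingBelow g n → g n ≤ g (suc n)
  mono-step n mono with <-cmp n (suc s)
  ... | tri< n<1+s _ _ = begin
    g n        ≡⟨ G-initial (<⇒≤ n<1+s) ⟩
    n          ≤⟨ n≤1+n n ⟩
    suc n      ≡⟨ G-initial n<1+s ⟨
    g (suc n)  ∎
    where open ≤-Reasoning
  ... | tri≈ _ refl _ = begin
    g (suc s)        ≡⟨ G-initial ≤-refl ⟩
    suc s            ≤⟨ s<c₁ ⟩
    c (suc s)        ≤⟨ c₁≤G₂₊ₛ ⟩
    g (suc (suc s))  ∎
    where open ≤-Reasoning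
  mono-step (suc k) mono | tri> _ _ (s≤s s<k) with suc (suc k) ≤? L
  ... | yes k+1<L = mono-middle s<k k+1<L mono
  ... | no  k+1≮L with m≤n⇒m<n∨m≡n (s≤s⁻¹ (≰⇒> k+1≮L))
  ...   | inj₁ L<k+1 = mono-recurrence (s≤s⁻¹ L<k+1) mono
  ...   | inj₂ L≡k+1 = +-cancelʳ-≤ 1 _ _ (begin
    g (suc k) + 1             ≤⟨ +-monoʳ-≤ (g (suc k)) 0<cL ⟩
    g (suc k) + c L           ≤⟨ mono-boundary s<k (sym L≡k+1) mono ⟩
    g (suc (suc k)) + 1       ∎)
    where open ≤-Reasoning

  nondecreasingBelow : ∀ n → NondecreasingBelow g n
  nondecreasingBelow zero    _ ()
  nondecreasingBelow (suc n) m m<n+1 with m≤n⇒m<n∨m≡n (s≤s⁻¹ m<n+1)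
  ... | inj₁ m<n  = nondecreasingBelow n m m<n
  ... | inj₂ refl = mono-step m (nondecreasingBelow m)

  G-mono : ∀ n → g n ≤ g (suc n)
  G-mono n = nondecreasingBelow (suc n) n ≤-refl

  G-mono-≤ : ∀ {m n} → m ≤ n → g m ≤ g n
  G-mono-≤ {n = zero}  z≤n   = ≤-refl
  G-mono-≤ {n = suc n} m≤n+1 with m≤n⇒m<n∨m≡n m≤n+1
  ... | inj₁ m<n+1 = ≤-trans (G-mono-≤ (s≤s⁻¹ m<n+1)) (G-mono n)
  ... | inj₂ refl  = ≤-refl

m+o≤n+1⇒k*m+o≤k*n+1 : ∀ {k m n o} → 0 < k → 0 < o → m + o ≤ n + 1 → k * m + o ≤ k * n + 1
m+o≤n+1⇒k*m+o≤k*n+1 {suc k} {m} {n} {suc o} _ _ m+o<n+1 = begin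
  suc k * m + suc o            ≡⟨ +-suc (suc k * m) o ⟩
  suc (suc k * m + o)          ≤⟨ s≤s (+-monoʳ-≤ (suc k * m) (m≤m+n o (k * o))) ⟩
  suc (suc k * m + suc k * o)  ≡⟨ cong suc (*-distribˡ-+ (suc k) m o) ⟨
  suc (suc k * (m + o))        ≤⟨ s≤s (*-monoʳ-≤ (suc k) m+o≤n) ⟩
  suc (suc k * n)              ≡⟨ +-comm 1 (suc k * n) ⟩
  suc k * n + 1                ∎
  where
  open ≤-Reasoning
  m+o≤n : m + o ≤ n
  m+o≤n = s≤s⁻¹ (subst₂ _≤_ (+-suc m o) (+-comm n 1) m+o<n+1)

module Inequality (s L′ : ℕ) (c : ℕ → ℕ) (c-deep : ∀ m → 1 ≤ m → m ≤ s → c m ≡ 0)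
                  (s<c₁ : s < c (suc s)) (2+s≤L : suc (suc s) ≤ suc L′)
                  (0<c₂ : 0 < c (suc (suc s))) (1<cL : 1 < c (suc L′)) where

  L : ℕ
  L = suc L′

  open ZLRS s L c
  open Evaluation s L c c-deep s<c₁
  open Monotone s L c c-deep s<c₁ (<⇒≤ 2+s≤L) (<⇒≤ 1<cL)

  s<L : s < L
  s<L = <⇒≤ 2+s≤L

  s<L′ : s < L′
  s<L′ = s≤s⁻¹ 2+s≤L

  two≤G₂₊ₛ : 2 ≤ g (suc (suc s))
  two≤G₂₊ₛ = subst (2 ≤_) (sym (G-first-middle 2+s≤L)) (+-monoˡ-≤ 1 (≤-trans (s≤s z≤n) s<c₁))

  two≤G₂ : 2 ≤ g 2
  two≤G₂ with 1 ≤? s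
  ... | yes 1≤s = ≤-reflexive (sym (G-initial (s≤s 1≤s)))
  ... | no  1≰s = subst (λ n → 2 ≤ g (suc (suc n))) (n<1⇒n≡0 (≰⇒> 1≰s)) two≤G₂₊ₛ

  G-boundary : g L + c L ≤ g (suc L) + 1
  G-boundary = mono-boundary s<L′ refl (nondecreasingBelow L)

  G-beyond : g (suc L) + c L ≤ g (suc (suc L))
  G-beyond = begin
    g (suc L) + c L                                          ≡⟨ cong (_+ c L) (G-recurrence s<L ≤-refl) ⟩
    lagSum (suc s) L (suc L) + c L                           ≡⟨ cong (_+ c L) (lagSum-endpoint s<L) ⟩
    lagSum (suc s) L′ (suc L) + c L + c L                    ≡⟨ +-assoc _ (c L) (c L) ⟩
    lagSum (suc s) L′ (suc L) + (c L + c L)                  ≤⟨ +-mono-≤ shifted doubled ⟩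
    lagSum (suc s) L′ (suc (suc L)) + c L * g (2 + L′ ∸ L′)  ≡⟨ lagSum-last (suc (suc L)) s<L ⟨
    lagSum (suc s) L (suc (suc L))                           ≡⟨ G-recurrence s<L (n≤1+n L) ⟨
    g (suc (suc L))                                          ∎
    where
    open ≤-Reasoning
    shifted : lagSum (suc s) L′ (suc L) ≤ lagSum (suc s) L′ (suc (suc L))
    shifted = lagSum-shift-mono (suc s) L′ (nondecreasingBelow (suc L)) z<s (≤-trans (n≤1+n L′) (n≤1+n L))
    doubled : c L + c L ≤ c L * g (2 + L′ ∸ L′)
    doubled = begin
      c L + c L                ≡⟨ cong₂ _+_ (*-identityʳ (c L)) (*-identityʳ (c L)) ⟨
      c L * 1 + c L * 1        ≡⟨ *-distribˡ-+ (c L) 1 1 ⟨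
      c L * 2                  ≤⟨ *-monoʳ-≤ (c L) two≤G₂ ⟩
      c L * g 2                ≡⟨ cong (λ n → c L * g n) (m+n∸n≡m 2 L′) ⟨
      c L * g (2 + L′ ∸ L′)    ∎

  two≤G₃₊ₛ : 2 ≤ g (suc (suc (suc s)))
  two≤G₃₊ₛ = ≤-trans two≤G₂₊ₛ (G-mono (suc (suc s)))

  cL<G₁₊L : c L < g (suc L)
  cL<G₁₊L = +-cancelʳ-≤ 1 (suc (c L)) (g (suc L)) (begin
    suc (c L) + 1     ≡⟨ +-comm (suc (c L)) 1 ⟩
    2 + c L           ≤⟨ +-monoˡ-≤ (c L) (≤-trans two≤G₂₊ₛ (G-mono-≤ 2+s≤L)) ⟩
    g L + c L         ≤⟨ G-boundary ⟩
    g (suc L) + 1     ∎)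
    where open ≤-Reasoning

  -- suc K = s + L + 2, written so that the indices suc K ∸ m below reduce by m+n∸n≡m.
  K : ℕ
  K = suc L + s

  L≤K : L ≤ K
  L≤K = ≤-trans (n≤1+n L) (m≤m+n (suc L) s)

  c₁ c₂ : ℕ
  c₁ = c (suc s)
  c₂ = c (suc (suc s))

  head-gain : c₁ * g (suc L) + c₁ * c L ≤ c₁ * g (suc (suc L))
  head-gain = ≤-trans (≤-reflexive (sym (*-distribˡ-+ c₁ _ _))) (*-monoʳ-≤ c₁ G-beyond)

  tail-gain : lagSum (suc (suc s)) L′ (suc K) + c L
            < lagSum (suc (suc s)) L′ (suc (suc K)) + g (suc (suc (suc s)))
  tail-gain with m≤n⇒m<n∨m≡n s<L′
  ... | inj₂ 1+s≡L′ = begin-strict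
    lagSum (suc (suc s)) L′ (suc K) + c L          ≡⟨ cong (_+ c L) (lagSum-empty (suc K) L′<2+s) ⟩
    c L                                            <⟨ cL<G₁₊L ⟩
    g (suc L)                                      ≤⟨ G-mono-≤ (s≤s L′<2+s) ⟩
    g (suc (suc (suc s)))                          ≡⟨ cong (_+ g (suc (suc (suc s)))) (lagSum-empty (suc (suc K)) L′<2+s) ⟨
    lagSum (suc (suc s)) L′ (suc (suc K)) + g (suc (suc (suc s))) ∎
    where
    open ≤-Reasoning
    L′<2+s : L′ < suc (suc s)
    L′<2+s = s≤s (≤-reflexive (sym 1+s≡L′))
  ... | inj₁ 2+s≤L′ = begin-strict
    lagSum (suc (suc s)) L′ (suc K) + c L          ≡⟨ cong (_+ c L) (lagSum-first (suc K) 2+s≤L′) ⟩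
    c₂ * g (suc K ∸ suc (suc s)) + R + c L         ≡⟨ cong (λ n → c₂ * g n + R + c L) (m+n∸n≡m L s) ⟩
    c₂ * g L + R + c L                             ≡⟨ xy∙z≈xz∙y (c₂ * g L) R (c L) ⟩
    c₂ * g L + c L + R                             ≤⟨ +-mono-≤ (m+o≤n+1⇒k*m+o≤k*n+1 0<c₂ (<⇒≤ 1<cL) G-boundary) R≤R′ ⟩
    c₂ * g (suc L) + 1 + R′                        ≡⟨ xy∙z≈xz∙y (c₂ * g (suc L)) 1 R′ ⟩
    c₂ * g (suc L) + R′ + 1                        <⟨ +-monoʳ-< (c₂ * g (suc L) + R′) two≤G₃₊ₛ ⟩
    c₂ * g (suc L) + R′ + g (suc (suc (suc s)))    ≡⟨ cong (λ n → c₂ * g n + R′ + g (suc (suc (suc s)))) (m+n∸n≡m (suc L) s) ⟨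
    c₂ * g (suc (suc K) ∸ suc (suc s)) + R′ + g (suc (suc (suc s)))
      ≡⟨ cong (_+ g (suc (suc (suc s)))) (lagSum-first (suc (suc K)) 2+s≤L′) ⟨
    lagSum (suc (suc s)) L′ (suc (suc K)) + g (suc (suc (suc s))) ∎
    where
    open ≤-Reasoning
    R R′ : ℕ
    R  = lagSum (suc (suc (suc s))) L′ (suc K)
    R′ = lagSum (suc (suc (suc s))) L′ (suc (suc K))
    R≤R′ : R ≤ R′
    R≤R′ = lagSum-shift-mono (suc (suc (suc s))) L′ (nondecreasingBelow (suc K)) z<s
             (≤-trans (n≤1+n L′) (≤-trans L≤K (n≤1+n K)))

  lhs-split : g (suc K) ≡ c₁ * g (suc L) + lagSum (suc (suc s)) L′ (suc K) + c L * (c₁ + 1)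
  lhs-split = begin
    g (suc K)
      ≡⟨ G-recurrence s<L L≤K ⟩
    lagSum (suc s) L (suc K)
      ≡⟨ lagSum-last (suc K) s<L ⟩
    lagSum (suc s) L′ (suc K) + c L * g (suc K ∸ L)
      ≡⟨ cong₂ _+_ (lagSum-first (suc K) s<L′) (cong (c L *_) G-at-2+s) ⟩
    c₁ * g (suc K ∸ suc s) + S + c L * (c₁ + 1)
      ≡⟨ cong (λ n → c₁ * g n + S + c L * (c₁ + 1)) (m+n∸n≡m (suc L) s) ⟩
    c₁ * g (suc L) + S + c L * (c₁ + 1)
      ∎
    where
    open ≡-Reasoning
    S : ℕ
    S = lagSum (suc (suc s)) L′ (suc K)
    G-at-2+s : g (suc K ∸ L) ≡ c₁ + 1
    G-at-2+s = begin
      g (suc L + s ∸ L′)             ≡⟨ cong (λ n → g (n ∸ L′)) (trans (+-suc L′ (suc s)) (cong suc (+-suc L′ s))) ⟨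
      g (L′ + suc (suc s) ∸ L′)      ≡⟨ cong g (m+n∸m≡n L′ (suc (suc s))) ⟩
      g (suc (suc s))                ≡⟨ G-first-middle 2+s≤L ⟩
      c₁ + 1                         ∎

  rhs-split : lagSum (suc s) L′ (suc (suc K)) ≡ c₁ * g (suc (suc L)) + lagSum (suc (suc s)) L′ (suc (suc K))
  rhs-split = trans (lagSum-first (suc (suc K)) s<L′)
                    (cong (λ n → c₁ * g n + lagSum (suc (suc s)) L′ (suc (suc K))) (m+n∸n≡m (suc (suc L)) s))

  inequality : g (suc K) < lagSum (suc s) L′ (suc (suc K)) + g (suc (suc (suc s)))
  inequality = begin-strict
    g (suc K)                                                      ≡⟨ lhs-split ⟩
    c₁ * g (suc L) + S + c L * (c₁ + 1)                            ≡⟨ regroup (c₁ * g (suc L)) S (c L) c₁ ⟩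
    (c₁ * g (suc L) + c₁ * c L) + (S + c L)                        <⟨ +-mono-≤-< head-gain tail-gain ⟩
    c₁ * g (suc (suc L)) + (S′ + G₃₊ₛ)                             ≡⟨ +-assoc (c₁ * g (suc (suc L))) S′ G₃₊ₛ ⟨
    c₁ * g (suc (suc L)) + S′ + G₃₊ₛ                               ≡⟨ cong (_+ G₃₊ₛ) rhs-split ⟨
    lagSum (suc s) L′ (suc (suc K)) + G₃₊ₛ                         ∎
    where
    open ≤-Reasoning
    S S′ G₃₊ₛ : ℕ
    S    = lagSum (suc (suc s)) L′ (suc K)
    S′   = lagSum (suc (suc s)) L′ (suc (suc K))
    G₃₊ₛ = g (suc (suc (suc s)))
    regroup : ∀ a t l b → a + t + l * (b + 1) ≡ (a + b * l) + (t + l)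
    regroup = solve-∀

lemma2p3 : (s L : ℕ) (c : ℕ → ℕ) → IsZLRR s L c →
    s < c (suc s) → s + 2 ≤ L → 0 < c (s + 2) → 1 < c L →
    G s L c (s + L + 2)
      < sumRange (suc s) (L ∸ 1) (λ m → c m * G s L c (L + s + 3 ∸ m)) + G s L c (s + 3)
lemma2p3 s zero     c _                s<c₁ s+2≤0 _ _ = contradiction (m+n≤o⇒n≤o s s+2≤0) λ ()
lemma2p3 s (suc L′) c (_ , c-deep , _) s<c₁ s+2≤L 0<c₂ 1<cL =
  subst₂ _<_ (cong g (sym (lhs-index s L′)))
             (cong₂ (λ n m → lagSum (suc s) L′ n + g m) (sym (rhs-index s L′)) (+-comm 3 s))
             inequality
  where
  open Inequality s L′ c c-deep s<c₁ (subst (_≤ suc L′) (+-comm s 2) s+2≤L)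
                  (subst (λ m → 0 < c m) (+-comm s 2) 0<c₂) 1<cL
  open ZLRS s (suc L′) c
  lhs-index : ∀ s L′ → s + suc L′ + 2 ≡ suc (suc (suc L′) + s)
  lhs-index = solve-∀
  rhs-index : ∀ s L′ → suc L′ + s + 3 ≡ suc (suc (suc (suc L′) + s))
  rhs-index = solve-∀
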